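{- Let $I$ be an independence relation on a finite alphabet $\Sigma$ and $\mathcal{S}=\langle S,s_0,\Sigma,\rightarrow\rangle$ an LTS. If $\mathcal{S}$ is $I$-diamond and, for all $(a,b)\in I$, $\mathrm{dom}\xrightarrow{ab}=\mathrm{dom}\xrightarrow{ba}$, then $T_\omega(\mathcal{S})$ is $I$-closed.
   Context: A dependence relation $D\subseteq\Sigma\times\Sigma$ is reflexive and symmetric; its complement $I$ is an independence relation. $\sim_I$ is the congruence on $\Sigma^\ast$ generated by $uabv\leftrightarrow ubav$ for $(a,b)\in I$. Its limit extension on $\Sigma^\omega$: $\sigma\sim_I^{\mathrm{lim}}\sigma'$ iff for every finite prefix $u$ of $\sigma$ there exist a finite prefix $u'$ of $\sigma'$ and $v\in\Sigma^\ast$ with $uv\sim_I u'$, and symmetrically with $\sigma,\sigma'$ exchanged. A language $L\subseteq\Sigma^\omega$ is $I$-closed if $\sigma\in L$ and $\sigma\sim_I^{\mathrm{lim}}\sigma'$ imply $\sigma'\in L$. $T_\omega(\mathcal{S})$ is the set of infinite words $a_0a_1\cdots$ having an infinite execution $s_0\xrightarrow{a_0}s_1\xrightarrow{a_1}\cdots$. $\mathcal{S}$ is $I$-diamond if for every $(a,b)\in I$, every $s\in\mathrm{dom}\xrightarrow{ab}\cap\mathrm{dom}\xrightarrow{ba}$ and every $s'$, $s\xrightarrow{ab}s'$ iff $s\xrightarrow{ba}s'$. -}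

module Defs where

open import Data.Nat using (ℕ; suc)
open import Data.List using (List; []; _∷_; _++_)
open import Data.Product using (Σ; ∃; _×_; _,_)
open import Relation.Binary.PropositionalEquality using (_≡_)
open import Relation.Nullary using (¬_)
open import Function.Bundles using (_⇔_)

Word : Set → Set
Word A = ℕ → A

prefix : {A : Set} → Word A → ℕ → List A
prefix σ ℕ.zero = []
prefix σ (suc n) = σ 0 ∷ prefix (λ i → σ (suc i)) n

-- An independence relation: complement of a reflexive symmetric
-- dependence relation, i.e. an irreflexive symmetric relation.
record IsIndependence {A : Set} (I : A → A → Set) : Set where
  field
    irrefl : ∀ a → ¬ I a a
    sym    : ∀ {a b} → I a b → I b a

-- ~_I : the congruence on finite words generated by  u a b v ↔ u b a v
-- for (a,b) ∈ I, given as its equivalence closure (the one-step swap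
-- relation is already compatible with concatenation).
data _~[_]_ {A : Set} (w : List A) (I : A → A → Set) : List A → Set where
  ~refl  : w ~[ I ] w
  ~sym   : ∀ {w'} → w' ~[ I ] w → w ~[ I ] w'
  ~trans : ∀ {w₂ w₃} → w ~[ I ] w₂ → w₂ ~[ I ] w₃ → w ~[ I ] w₃
  ~swap  : ∀ u a b v → w ≡ (u ++ a ∷ b ∷ v) → I a b →
           w ~[ I ] (u ++ b ∷ a ∷ v)

_~lim[_]_ : {A : Set} → Word A → (A → A → Set) → Word A → Set
σ ~lim[ I ] σ' =
  (∀ n → ∃ λ m → ∃ λ v → (prefix σ n ++ v) ~[ I ] prefix σ' m) ×
  (∀ n → ∃ λ m → ∃ λ v → (prefix σ' n ++ v) ~[ I ] prefix σ m)

IClosed : {A : Set} → (A → A → Set) → (Word A → Set) → Set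
IClosed I L = ∀ σ σ' → L σ → σ ~lim[ I ] σ' → L σ'

record LTS (A : Set) : Set₁ where
  field
    State : Set
    s₀    : State
    _⟶[_]_ : State → A → State → Set

module _ {A : Set} (𝒮 : LTS A) where
  open LTS 𝒮

  Step2 : State → A → A → State → Set
  Step2 s a b s' = ∃ λ t → (s ⟶[ a ] t) × (t ⟶[ b ] s')

  Dom2 : A → A → State → Set
  Dom2 a b s = ∃ λ s' → Step2 s a b s'

  IDiamond : (A → A → Set) → Set
  IDiamond I = ∀ a b → I a b → ∀ s → Dom2 a b s → Dom2 b a s →
               ∀ s' → Step2 s a b s' ⇔ Step2 s b a s'

  Tω : Word A → Set
  Tω σ = ∃ λ (ρ : ℕ → State) → (ρ 0 ≡ s₀) × (∀ i → ρ i ⟶[ σ i ] ρ (suc i))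

-- A run of the LTS along a word can be transported along ~_I one swap at a
-- time, since the two hypotheses together say that s -ab-> s' iff s -ba-> s'
-- whenever (a,b) ∈ I.  Given an execution ρ of σ and σ ~lim σ', an execution
-- of σ' is built letter by letter, keeping the invariant that the state
-- reached after σ'[0..n) has a run along some v with σ'[0..n) v ~_I σ[0..m)
-- ending in ρ m.  To take the step σ' n, pad this equivalence and one for
-- σ'[0..n] to a common prefix of σ and cancel σ'[0..n) on the left: the
-- padded completion is then equivalent to a word starting with σ' n.  Left
-- cancellation works by deleting first occurrences, which needs decidable
-- equality; that is all the finiteness of Σ is used for.

module Submission where

open import Defs
open import Data.Nat using (ℕ; zero; suc; _+_; _≤_; _⊔_)
open import Data.Nat.Properties using (m≤n⇒∃[o]m+o≡n; m≤m⊔n; m≤n⊔m)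
open import Data.Fin using (Fin)
open import Data.Fin.Properties using (inj⇒≟)
open import Data.List using (List; []; _∷_; _++_)
open import Data.List.Properties using (++-assoc)
open import Data.Product using (Σ; ∃; _×_; _,_; proj₁; proj₂)
open import Data.Empty using (⊥-elim)
open import Function.Bundles using (_⇔_; _↔_; mk⇔; Equivalence)
open import Function.Properties.Inverse using (↔⇒↣)
import Function.Properties.Equivalence as ⇔
open import Relation.Binary.Bundles using (Setoid)
open import Relation.Binary.Definitions using (DecidableEquality)
open import Relation.Binary.PropositionalEquality using (_≡_; _≢_; refl; sym; cong; subst)
open import Relation.Nullary using (yes; no)
import Relation.Binary.Reasoning.Setoid as ≈-Reasoning

module _ {A : Set} {I : A → A → Set} where

  ~-setoid : Setoid _ _
  ~-setoid = record
    { Carrier = List A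
    ; _≈_ = _~[ I ]_
    ; isEquivalence = record { refl = ~refl ; sym = ~sym ; trans = ~trans }
    }

  ≡⇒~ : ∀ {w w'} → w ≡ w' → w ~[ I ] w'
  ≡⇒~ refl = ~refl

  ∷⁺ : ∀ x {w w'} → w ~[ I ] w' → (x ∷ w) ~[ I ] (x ∷ w')
  ∷⁺ x ~refl = ~refl
  ∷⁺ x (~sym p) = ~sym (∷⁺ x p)
  ∷⁺ x (~trans p q) = ~trans (∷⁺ x p) (∷⁺ x q)
  ∷⁺ x (~swap u a b v refl i) = ~swap (x ∷ u) a b v refl i

  ++⁺ʳ : ∀ z {w w'} → w ~[ I ] w' → (w ++ z) ~[ I ] (w' ++ z)
  ++⁺ʳ z ~refl = ~refl
  ++⁺ʳ z (~sym p) = ~sym (++⁺ʳ z p)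
  ++⁺ʳ z (~trans p q) = ~trans (++⁺ʳ z p) (++⁺ʳ z q)
  ++⁺ʳ z (~swap u a b v refl i) =
    ~trans (~swap u a b (v ++ z) (++-assoc u (a ∷ b ∷ v) z) i)
           (≡⇒~ (sym (++-assoc u (b ∷ a ∷ v) z)))

  module _ (_≟_ : DecidableEquality A) where

    delete : A → List A → List A
    delete c [] = []
    delete c (x ∷ w) with x ≟ c
    ... | yes _ = w
    ... | no _ = x ∷ delete c w

    delete-head : ∀ c w → delete c (c ∷ w) ≡ w
    delete-head c w with c ≟ c
    ... | yes _ = refl
    ... | no c≢c = ⊥-elim (c≢c refl)

    delete-miss : ∀ {x c} → x ≢ c → ∀ w → delete c (x ∷ w) ≡ x ∷ delete c w
    delete-miss {x} {c} x≢c w with x ≟ c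
    ... | yes x≡c = ⊥-elim (x≢c x≡c)
    ... | no _ = refl

    delete-swap : ∀ c u a b v → I a b →
                  delete c (u ++ a ∷ b ∷ v) ~[ I ] delete c (u ++ b ∷ a ∷ v)
    delete-swap c (x ∷ u) a b v i with x ≟ c
    ... | yes _ = ~swap u a b v refl i
    ... | no _ = ∷⁺ x (delete-swap c u a b v i)
    delete-swap c [] a b v i with a ≟ c | b ≟ c
    ... | yes refl | yes refl = ~refl
    ... | yes refl | no _ = ∷⁺ b (≡⇒~ (sym (delete-head a v)))
    ... | no _ | yes refl = ∷⁺ a (≡⇒~ (delete-head b v))
    ... | no a≢c | no b≢c = begin
      a ∷ delete c (b ∷ v)  ≡⟨ cong (a ∷_) (delete-miss b≢c v) ⟩
      a ∷ b ∷ delete c v    ≈⟨ ~swap [] a b (delete c v) refl i ⟩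
      b ∷ a ∷ delete c v    ≡⟨ cong (b ∷_) (delete-miss a≢c v) ⟨
      b ∷ delete c (a ∷ v)  ∎
      where open ≈-Reasoning ~-setoid

    delete⁺ : ∀ c {w w'} → w ~[ I ] w' → delete c w ~[ I ] delete c w'
    delete⁺ c ~refl = ~refl
    delete⁺ c (~sym p) = ~sym (delete⁺ c p)
    delete⁺ c (~trans p q) = ~trans (delete⁺ c p) (delete⁺ c q)
    delete⁺ c (~swap u a b v refl i) = delete-swap c u a b v i

    ++-cancelˡ : ∀ p {w w'} → (p ++ w) ~[ I ] (p ++ w') → w ~[ I ] w'
    ++-cancelˡ [] q = q
    ++-cancelˡ (c ∷ p) {w} {w'} q =
      ++-cancelˡ p (begin
        p ++ w                 ≡⟨ delete-head c (p ++ w) ⟨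
        delete c (c ∷ p ++ w)  ≈⟨ delete⁺ c q ⟩
        delete c (c ∷ p ++ w') ≡⟨ delete-head c (p ++ w') ⟩
        p ++ w'                ∎)
      where open ≈-Reasoning ~-setoid

prefix-+ : ∀ {A : Set} (σ : Word A) m k →
           prefix σ (m + k) ≡ prefix σ m ++ prefix (λ i → σ (m + i)) k
prefix-+ σ zero k = refl
prefix-+ σ (suc m) k = cong (σ 0 ∷_) (prefix-+ (λ i → σ (suc i)) m k)

prefix-suc-++ : ∀ {A : Set} (σ : Word A) n v → prefix σ (suc n) ++ v ≡ prefix σ n ++ σ n ∷ v
prefix-suc-++ σ zero v = refl
prefix-suc-++ σ (suc n) v = cong (σ 0 ∷_) (prefix-suc-++ (λ i → σ (suc i)) n v)

module Runs {A : Set} (𝒮 : LTS A) where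
  open LTS 𝒮

  data Run : State → List A → State → Set where
    []  : ∀ {s} → Run s [] s
    _∷_ : ∀ {s a t w r} → s ⟶[ a ] t → Run t w r → Run s (a ∷ w) r

  Commuting : (A → A → Set) → Set
  Commuting I = ∀ {a b} → I a b → ∀ {s s'} → Step2 𝒮 s a b s' ⇔ Step2 𝒮 s b a s'

  diamond⇒commuting : ∀ {I} → IDiamond 𝒮 I →
                      (∀ a b → I a b → ∀ s → Dom2 𝒮 a b s ⇔ Dom2 𝒮 b a s) →
                      Commuting I
  diamond⇒commuting {I} diamond dom {a} {b} i {s} {s'} = mk⇔
    (λ ab → Equivalence.to (diamond⇔ (_ , ab) (Equivalence.to (dom a b i s) (_ , ab))) ab)
    (λ ba → Equivalence.from (diamond⇔ (Equivalence.from (dom a b i s) (_ , ba)) (_ , ba)) ba)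
    where
    diamond⇔ : Dom2 𝒮 a b s → Dom2 𝒮 b a s → Step2 𝒮 s a b s' ⇔ Step2 𝒮 s b a s'
    diamond⇔ ab ba = diamond a b i s ab ba s'

  Run-swap : ∀ {a b} → (∀ {s s'} → Step2 𝒮 s a b s' → Step2 𝒮 s b a s') →
             ∀ u {v s r} → Run s (u ++ a ∷ b ∷ v) r → Run s (u ++ b ∷ a ∷ v) r
  Run-swap commute [] (st₁ ∷ st₂ ∷ run) with commute (_ , st₁ , st₂)
  ... | _ , st₁' , st₂' = st₁' ∷ st₂' ∷ run
  Run-swap commute (x ∷ u) (st ∷ run) = st ∷ Run-swap commute u run

  Run-resp-~ : ∀ {I} → Commuting I → ∀ {w w' s r} → w ~[ I ] w' → Run s w r ⇔ Run s w' r
  Run-resp-~ commuting ~refl = ⇔.refl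
  Run-resp-~ commuting (~sym p) = ⇔.sym (Run-resp-~ commuting p)
  Run-resp-~ commuting (~trans p q) = ⇔.trans (Run-resp-~ commuting p) (Run-resp-~ commuting q)
  Run-resp-~ commuting (~swap u a b v refl i) =
    mk⇔ (Run-swap (Equivalence.to (commuting i)) u) (Run-swap (Equivalence.from (commuting i)) u)

  _++ᴿ_ : ∀ {s u t w r} → Run s u t → Run t w r → Run s (u ++ w) r
  [] ++ᴿ run' = run'
  (st ∷ run) ++ᴿ run' = st ∷ (run ++ᴿ run')

  uncons : ∀ {s a w r} → Run s (a ∷ w) r → ∃ λ t → s ⟶[ a ] t × Run t w r
  uncons (st ∷ run) = _ , st , run

  Execution : Word A → (ℕ → State) → Set
  Execution σ ρ = ∀ i → ρ i ⟶[ σ i ] ρ (suc i)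

  Execution-segment : ∀ σ ρ → Execution σ ρ → ∀ m k →
                      Run (ρ m) (prefix (λ i → σ (m + i)) k) (ρ (m + k))
  Execution-segment σ ρ ex zero zero = []
  Execution-segment σ ρ ex zero (suc k) =
    ex 0 ∷ Execution-segment (λ i → σ (suc i)) (λ i → ρ (suc i)) (λ i → ex (suc i)) 0 k
  Execution-segment σ ρ ex (suc m) k =
    Execution-segment (λ i → σ (suc i)) (λ i → ρ (suc i)) (λ i → ex (suc i)) m k

  ~-extend : ∀ {I σ ρ u m M} → Execution σ ρ → u ~[ I ] prefix σ m → m ≤ M →
             ∃ λ w → (u ++ w) ~[ I ] prefix σ M × Run (ρ m) w (ρ M)
  ~-extend {σ = σ} {ρ} {m = m} ex u~ m≤M with m≤n⇒∃[o]m+o≡n m≤M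
  ... | k , refl =
    prefix (λ i → σ (m + i)) k ,
    ~trans (++⁺ʳ _ u~) (≡⇒~ (sym (prefix-+ σ m k))) ,
    Execution-segment σ ρ ex m k

open Runs using (Commuting; diamond⇒commuting; Execution)

module Closure {A : Set} (_≟_ : DecidableEquality A) {I : A → A → Set}
  (𝒮 : LTS A) (commuting : Commuting 𝒮 I)
  {σ σ' : Word A} {ρ : ℕ → LTS.State 𝒮}
  (ρ₀ : ρ 0 ≡ LTS.s₀ 𝒮) (ex : Execution 𝒮 σ ρ)
  (σ'≼σ : ∀ n → ∃ λ m → ∃ λ v → (prefix σ' n ++ v) ~[ I ] prefix σ m)
  where
  open LTS 𝒮
  open Runs 𝒮

  record Completable (n : ℕ) (t : State) : Set where
    field
      m     : ℕ
      rest  : List A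
      trace : (prefix σ' n ++ rest) ~[ I ] prefix σ m
      run   : Run t rest (ρ m)

  step : ∀ {n t} → Completable n t → ∃ λ t' → t ⟶[ σ' n ] t' × Completable (suc n) t'
  step {n} {t} c = extend (σ'≼σ (suc n))
    where
    open Completable c
    open ≈-Reasoning ~-setoid

    extend : (∃ λ m' → ∃ λ v' → (prefix σ' (suc n) ++ v') ~[ I ] prefix σ m') →
             ∃ λ t' → t ⟶[ σ' n ] t' × Completable (suc n) t'
    extend (m' , v' , trace') with ~-extend ex trace (m≤m⊔n m m')
                                 | ~-extend ex trace' (m≤n⊔m m m')
    ... | w , trace-w , run-w | w' , trace-w' , _ =
      let t' , st , run' = uncons (Equivalence.to (Run-resp-~ commuting reordered) (run ++ᴿ run-w))
      in t' , st , record { m = m ⊔ m' ; rest = v' ++ w' ; trace = trace'' ; run = run' }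
      where
      trace'' : (prefix σ' (suc n) ++ v' ++ w') ~[ I ] prefix σ (m ⊔ m')
      trace'' = ~trans (≡⇒~ (sym (++-assoc (prefix σ' (suc n)) v' w'))) trace-w'

      reordered : (rest ++ w) ~[ I ] (σ' n ∷ v' ++ w')
      reordered = ++-cancelˡ _≟_ (prefix σ' n) (begin
        prefix σ' n ++ rest ++ w        ≡⟨ ++-assoc (prefix σ' n) rest w ⟨
        (prefix σ' n ++ rest) ++ w      ≈⟨ trace-w ⟩
        prefix σ (m ⊔ m')               ≈⟨ trace'' ⟨
        prefix σ' (suc n) ++ v' ++ w'   ≡⟨ prefix-suc-++ σ' n (v' ++ w') ⟩
        prefix σ' n ++ σ' n ∷ v' ++ w'  ∎)

  completable : ∀ n → Σ State (Completable n)
  completable zero =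
    s₀ , record { m = 0 ; rest = [] ; trace = ~refl ; run = subst (λ s → Run s [] (ρ 0)) ρ₀ [] }
  completable (suc n) = let t' , _ , c' = step (proj₂ (completable n)) in t' , c'

  σ'∈Tω : Tω 𝒮 σ'
  σ'∈Tω = (λ n → proj₁ (completable n)) , refl ,
          (λ n → proj₁ (proj₂ (step (proj₂ (completable n)))))

lemma32 : {Σ' : Set} (k : ℕ) → Σ' ↔ Fin k →
          (I : Σ' → Σ' → Set) → IsIndependence I →
          (𝒮 : LTS Σ') → IDiamond 𝒮 I →
          (∀ a b → I a b → ∀ s → Dom2 𝒮 a b s ⇔ Dom2 𝒮 b a s) →
          IClosed I (Tω 𝒮)
lemma32 _ Σ'↔Fin I _ 𝒮 diamond dom σ σ' (_ , ρ₀ , ex) (_ , σ'≼σ) =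
  Closure.σ'∈Tω (inj⇒≟ (↔⇒↣ Σ'↔Fin)) 𝒮 (diamond⇒commuting 𝒮 diamond dom) ρ₀ ex σ'≼σ
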